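{- For all computation types $\rho, \rho'$ and value type $\tau$: if $\rho \le \tau/\rho' \Rightarrow \rho$, then $\rho'$ is pure, i.e.\ $\rho' = \tau''/\square$ for some value type $\tau''$.
   Context: ATM types: base types $b ::= \mathtt{unit} \mid \mathtt{bool}$; value types $\tau ::= b \mid \tau \to \rho$; computation types $\rho ::= \tau/\square \mid \tau/\rho_1 \Rightarrow \rho_2$ (the first form is called pure, the second effectful). Subtyping $\le$ is the least relation with: $b \le b$; $\tau_1\to\rho_1 \le \tau_2\to\rho_2$ if $\tau_2\le\tau_1$ and $\rho_1\le\rho_2$; $\tau_1/\square \le \tau_2/\square$ if $\tau_1\le\tau_2$; $\tau_1/\rho_1\Rightarrow\rho_1' \le \tau_2/\rho_2\Rightarrow\rho_2'$ if $\tau_1\le\tau_2$, $\rho_2\le\rho_1$, $\rho_1'\le\rho_2'$; $\tau_1/\square \le \tau_2/\rho_1\Rightarrow\rho_2$ if $\tau_1\le\tau_2$ and $\rho_1\le\rho_2$. -}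

module Defs where

open import Data.Product using (Σ; _,_)
open import Relation.Binary.PropositionalEquality using (_≡_)

data BaseTy : Set where
  unit : BaseTy
  bool : BaseTy

data VTy : Set
data CTy : Set

data VTy where
  base : BaseTy → VTy
  _⇾_  : VTy → CTy → VTy

data CTy where
  _/□      : VTy → CTy
  _/_⇒_    : VTy → CTy → CTy → CTy

data _≤v_ : VTy → VTy → Set
data _≤c_ : CTy → CTy → Set

data _≤v_ where
  ≤-base : ∀ {b} → base b ≤v base b
  ≤-fun  : ∀ {τ₁ τ₂ ρ₁ ρ₂} → τ₂ ≤v τ₁ → ρ₁ ≤c ρ₂ → (τ₁ ⇾ ρ₁) ≤v (τ₂ ⇾ ρ₂)

data _≤c_ where
  ≤-pure   : ∀ {τ₁ τ₂} → τ₁ ≤v τ₂ → (τ₁ /□) ≤c (τ₂ /□)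
  ≤-eff    : ∀ {τ₁ τ₂ ρ₁ ρ₁' ρ₂ ρ₂'} → τ₁ ≤v τ₂ → ρ₂ ≤c ρ₁ → ρ₁' ≤c ρ₂' →
             (τ₁ / ρ₁ ⇒ ρ₁') ≤c (τ₂ / ρ₂ ⇒ ρ₂')
  ≤-pureEff : ∀ {τ₁ τ₂ ρ₁ ρ₂} → τ₁ ≤v τ₂ → ρ₁ ≤c ρ₂ → (τ₁ /□) ≤c (τ₂ / ρ₁ ⇒ ρ₂)

IsPure : CTy → Set
IsPure ρ = Σ VTy (λ τ → ρ ≡ (τ /□))

-- If ρ = τ₁/ρ₁ ⇒ ρ₁' lies below τ/ρ' ⇒ ρ, then ρ' ≤ ρ₁ and ρ₁' ≤ ρ, so the same
-- situation recurs for ρ₁' with ρ' now below the effect ρ₁. Descending through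
-- the result types of ρ reaches a pure one, where only τ₁/□ ≤ τ₂/ρ₁ ⇒ ρ₂ applies
-- and places ρ' below a pure type; and only pure types lie below a pure type.
module Submission where

open import Defs
open import Data.Product using (_,_)
open import Relation.Binary.PropositionalEquality using (refl)

≤v-refl : ∀ τ → τ ≤v τ
≤c-refl : ∀ ρ → ρ ≤c ρ
≤v-refl (base b) = ≤-base
≤v-refl (τ ⇾ ρ)  = ≤-fun (≤v-refl τ) (≤c-refl ρ)
≤c-refl (τ /□)       = ≤-pure (≤v-refl τ)
≤c-refl (τ / ρ ⇒ ρ') = ≤-eff (≤v-refl τ) (≤c-refl ρ) (≤c-refl ρ')

≤v-trans : ∀ {τ₁ τ₂ τ₃} → τ₁ ≤v τ₂ → τ₂ ≤v τ₃ → τ₁ ≤v τ₃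
≤c-trans : ∀ {ρ₁ ρ₂ ρ₃} → ρ₁ ≤c ρ₂ → ρ₂ ≤c ρ₃ → ρ₁ ≤c ρ₃
≤v-trans ≤-base      ≤-base        = ≤-base
≤v-trans (≤-fun p q) (≤-fun p′ q′) = ≤-fun (≤v-trans p′ p) (≤c-trans q q′)
≤c-trans (≤-pure p)      (≤-pure q)       = ≤-pure (≤v-trans p q)
≤c-trans (≤-pure p)      (≤-pureEff q r)  = ≤-pureEff (≤v-trans p q) r
≤c-trans (≤-eff p q r)   (≤-eff p′ q′ r′) =
  ≤-eff (≤v-trans p p′) (≤c-trans q′ q) (≤c-trans r r′)
≤c-trans (≤-pureEff p q) (≤-eff p′ q′ r′) =
  ≤-pureEff (≤v-trans p p′) (≤c-trans q′ (≤c-trans q r′))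

≤-pure⇒IsPure : ∀ {ρ τ} → ρ ≤c (τ /□) → IsPure ρ
≤-pure⇒IsPure (≤-pure {τ₁ = τ} _) = τ , refl

≤-self-effect⇒below-effect-pure :
  ∀ {ρ σ ρ' τ} → ρ ≤c (τ / σ ⇒ ρ) → ρ' ≤c σ → IsPure ρ'
≤-self-effect⇒below-effect-pure (≤-pureEff _ σ≤ρ) ρ'≤σ =
  ≤-pure⇒IsPure (≤c-trans ρ'≤σ σ≤ρ)
≤-self-effect⇒below-effect-pure (≤-eff _ σ≤ρ₁ ρ₁'≤ρ) ρ'≤σ =
  ≤-self-effect⇒below-effect-pure ρ₁'≤ρ (≤c-trans ρ'≤σ σ≤ρ₁)

lemma1 : (ρ ρ' : CTy) (τ : VTy) → ρ ≤c (τ / ρ' ⇒ ρ) → IsPure ρ'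
lemma1 ρ ρ' τ ρ≤ = ≤-self-effect⇒below-effect-pure ρ≤ (≤c-refl ρ')
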